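{- Let $(T,\omega)$ and $(T',\omega')$ be weighted stars such that $M_{(T,\mathsf m_\omega)}(\mathbf z)=M_{(T',\mathsf m_{\omega'})}(\mathbf z)$. Then $(T,\omega)$ and $(T',\omega')$ are $\omega$-isomorphic. (That is, a weighted star can be reconstructed from its $M$-polynomial.)
   Context: A weighted tree is $(T,\omega)$, $T$ a tree, $\omega:V(T)\to\{1,2,\dots\}$; it is a weighted star if $T$ is a star (a tree with a vertex adjacent to all others). Two weighted graphs are $\omega$-isomorphic if there is a graph isomorphism preserving weights. The marked version $\mathsf m_\omega$ gives vertex $v$ the mark $(\omega(v),0)$; marks are pairs $(w,d)$ with dot-sum $(w,d)\dotplus(w',d')=(w+w',d+d'+1)$. For a marked tree, $M_{(T,\mathsf m)}(\mathbf z)=\sum_{A\subseteq E(T)}\prod_C z_{\mathsf m(C)}$, where $C$ ranges over connected components of $(V(T),A)$, $\mathsf m(C)$ is the dot-sum of the marks of the vertices of $C$, and the $z_{w,d}$ are commuting indeterminates. -}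

module Defs where

open import Data.Nat using (ℕ; zero; suc; _+_; _≥_; _∸_)
open import Data.Bool using (Bool; true; false; _∧_; _∨_; not; if_then_else_; T?)
open import Data.Fin using (Fin; _<?_; _≟_)
open import Data.List using (List; []; _∷_; map; _++_; filter; length; allFin; concatMap)
open import Data.Bool.ListAction using (any)
open import Data.Product using (_×_; _,_; Σ; ∃; proj₁; proj₂)
open import Relation.Nullary using (¬_)
open import Relation.Nullary.Decidable using (⌊_⌋)
open import Relation.Binary.PropositionalEquality using (_≡_)
open import Function.Bundles using (_↔_; Inverse)
open import Data.List.Relation.Binary.Permutation.Propositional as PermP using (↭-setoid)
import Data.List.Relation.Binary.Permutation.Setoid as PermS

record Graph (n : ℕ) : Set where
  field
    adj    : Fin n → Fin n → Bool
    sym    : ∀ i j → adj i j ≡ adj j i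
    irrefl : ∀ i → adj i i ≡ false
open Graph public

Edge : ℕ → Set
Edge n = Fin n × Fin n

edges : ∀ {n} → Graph n → List (Edge n)
edges {n} G =
  concatMap (λ i → concatMap (λ j →
    if ⌊ i <? j ⌋ ∧ adj G i j then (i , j) ∷ [] else []) (allFin n)) (allFin n)

sublists : ∀ {a} {X : Set a} → List X → List (List X)
sublists []       = [] ∷ []
sublists (x ∷ xs) = map (x ∷_) (sublists xs) ++ sublists xs

joinedBy : ∀ {n} → List (Edge n) → Fin n → Fin n → Bool
joinedBy A u v = any (λ e → (⌊ proj₁ e ≟ u ⌋ ∧ ⌊ proj₂ e ≟ v ⌋)
                          ∨ (⌊ proj₁ e ≟ v ⌋ ∧ ⌊ proj₂ e ≟ u ⌋)) A

reachWithin : ∀ {n} → ℕ → List (Edge n) → Fin n → Fin n → Bool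
reachWithin zero    A u v = ⌊ u ≟ v ⌋
reachWithin {n} (suc k) A u v =
  reachWithin k A u v ∨ any (λ w → reachWithin k A u w ∧ joinedBy A w v) (allFin n)

-- u and v lie in the same connected component of (Fin n, A)
-- (walks of length ≤ n suffice, since there are n vertices)
sameComp : ∀ {n} → List (Edge n) → Fin n → Fin n → Bool
sameComp {n} A u v = reachWithin n A u v

Mark : Set
Mark = ℕ × ℕ

_∔_ : Mark → Mark → Mark
(w , d) ∔ (w' , d') = (w + w' , d + d' + 1)

-- dot-sum of a nonempty list of marks (the value on [] is never used)
⨁ : List Mark → Mark
⨁ []           = (0 , 0)
⨁ (m ∷ [])     = m
⨁ (m ∷ m' ∷ ms) = m ∔ ⨁ (m' ∷ ms)

-- The monomial ∏_C z_{m(C)} attached to A ⊆ E, as the multiset (list up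
-- to permutation) of the indices m(C) of its variables.  Each component C
-- is represented by its least vertex v.

isLeastInComp : ∀ {n} → List (Edge n) → Fin n → Bool
isLeastInComp {n} A v = not (any (λ u → sameComp A v u ∧ ⌊ u <? v ⌋) (allFin n))

compMark : ∀ {n} → (Fin n → Mark) → List (Edge n) → Fin n → Mark
compMark {n} m A v = ⨁ (map m (filter (λ u → T? (sameComp A v u)) (allFin n)))

monomial : ∀ {n} → (Fin n → Mark) → List (Edge n) → List Mark
monomial {n} m A = map (compMark m A) (filter (λ v → T? (isLeastInComp A v)) (allFin n))

-- Marked graphs and the polynomial M_{(G,m)}(z) = Σ_{A ⊆ E} ∏_C z_{m(C)},
-- represented as the multiset of its monomials (one per A ⊆ E).

Mpoly : ∀ {n} → Graph n → (Fin n → Mark) → List (List Mark)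
Mpoly G m = map (monomial m) (sublists (edges G))

-- Equality of polynomials with coefficients in ℕ: the multisets of
-- monomials coincide, monomials being multisets of variables z_{w,d}.
_≈Poly_ : List (List Mark) → List (List Mark) → Set
P ≈Poly Q = PermS._↭_ (↭-setoid {A = Mark}) P Q

Connected : ∀ {n} → Graph n → Set
Connected {n} G = ∀ u v → sameComp (edges G) u v ≡ true

IsTree : ∀ {n} → Graph n → Set
IsTree {n} G = n ≥ 1 × Connected G × length (edges G) ≡ n ∸ 1

IsStar : ∀ {n} → Graph n → Set
IsStar {n} G = IsTree G × Σ (Fin n) (λ c → ∀ v → ¬ (v ≡ c) → adj G c v ≡ true)

record WeightedTree : Set where
  field
    size   : ℕ
    graph  : Graph size
    isTree : IsTree graph
    weight : Fin size → ℕ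
    wpos   : ∀ v → weight v ≥ 1
open WeightedTree public

IsWeightedStar : WeightedTree → Set
IsWeightedStar T = IsStar (graph T)

markω : (T : WeightedTree) → Fin (size T) → Mark
markω T v = (weight T v , 0)

M : WeightedTree → List (List Mark)
M T = Mpoly (graph T) (markω T)

ωIsomorphic : WeightedTree → WeightedTree → Set
ωIsomorphic T T' = Σ (Fin (size T) ↔ Fin (size T')) λ f →
  (∀ i j → adj (graph T') (Inverse.to f i) (Inverse.to f j) ≡ adj (graph T) i j)
  × (∀ i → weight T' (Inverse.to f i) ≡ weight T i)

{-# OPTIONS --safe #-}
-- The polynomial has 2^(n−1) monomials, so equal polynomials force equal numbers
-- of vertices n.  The monomial of A = ∅ is the only one with n variables, and it is
-- the multiset of vertex marks (ω v, 0); hence the weights agree up to a permutation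
-- π.  For n ≥ 3 the monomials with n − 1 variables are exactly those of single edges
-- {c, ℓ} at the centre c, whose only variable with d ≠ 0 is z_{ω c + ω ℓ, 1}.
-- Summing d·w over them gives (n − 2)·ω c + Σ ω, which determines ω c; for n ≤ 2
-- every vertex is a centre.  Composing π with a transposition then sends centre to
-- centre, and a bijection between stars that matches their centres preserves
-- adjacency.
module Submission where

open import Defs hiding (sym)
open import Data.Bool using (Bool; true; false; _∧_; _∨_; not; if_then_else_; T?)
open import Data.Bool.ListAction using (any)
open import Data.Bool.Properties using (T-≡; ∧-zeroʳ; ∨-identityʳ; not-involutive)
open import Data.Empty using (⊥-elim)
open import Data.Fin as F using (Fin; zero; suc; _≟_; _<?_)
import Data.Fin.Permutation as Perm
open import Data.Fin.Permutation using (Permutation; _⟨$⟩ʳ_; _⟨$⟩ˡ_; _∘ₚ_)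
import Data.Fin.Permutation.Components as PC
import Data.Fin.Properties as FP
open import Data.List
  using (List; []; _∷_; map; _++_; filter; length; allFin; tabulate; lookup; concatMap; cartesianProduct)
open import Data.List.Membership.Propositional using (_∈_)
import Data.List.Membership.Propositional.Properties as MP
import Data.List.Properties as LP
import Data.List.Relation.Binary.Permutation.Homogeneous as Hom
import Data.List.Relation.Binary.Permutation.Propositional as PermP
import Data.List.Relation.Binary.Permutation.Propositional.Properties as PPP
import Data.List.Relation.Binary.Permutation.Setoid as PermS
import Data.List.Relation.Binary.Permutation.Setoid.Properties as PermSP
import Data.List.Relation.Unary.All as All
import Data.List.Relation.Unary.All.Properties as AllP
open import Data.List.Relation.Unary.AllPairs using (_∷_)
open import Data.List.Relation.Unary.Any using (here; there)
open import Data.List.Relation.Unary.Unique.Propositional using (Unique)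
import Data.List.Relation.Unary.Unique.Propositional.Properties as UP
import Data.Nat as ℕ
open import Data.Nat using (ℕ; zero; suc; _+_; _*_; _∸_; _^_; _≤_; _<_; z≤n; s≤s)
open import Data.Nat.ListAction using (sum)
open import Data.Nat.ListAction.Properties using (sum-++; sum-↭)
open import Data.Nat.Properties hiding (_≟_; _<?_)
open import Algebra.Properties.CommutativeMonoid.Sum +-0-commutativeMonoid
  using (sum-syntax; sum-cong-≗; ∑-distrib-+; ∑-comm; ∑-permute) renaming (sum to ∑)
open import Data.Product using (Σ; ∃; _×_; _,_; proj₁; proj₂)
open import Data.Sum using (_⊎_; inj₁; inj₂)
open import Function using (_∘_)
open import Function.Bundles using (Equivalence)
open import Relation.Binary.Definitions using (tri<; tri≈; tri>)
open import Relation.Binary.PropositionalEquality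
open import Relation.Nullary using (Dec; yes; no; ¬_)
open import Relation.Nullary.Decidable using (⌊_⌋; dec-true)

module SP = PermSP (PermP.↭-setoid {A = Mark})

witness : ∀ {A : Set} (a? : Dec A) → ⌊ a? ⌋ ≡ true → A
witness (yes a) _ = a

⌊⌋-true : ∀ {A : Set} (a? : Dec A) → A → ⌊ a? ⌋ ≡ true
⌊⌋-true (yes _) _ = refl
⌊⌋-true (no ¬a) a = ⊥-elim (¬a a)

⌊⌋-false : ∀ {A : Set} (a? : Dec A) → ¬ A → ⌊ a? ⌋ ≡ false
⌊⌋-false (yes a) ¬a = ⊥-elim (¬a a)
⌊⌋-false (no _)  _  = refl

∨-introˡ : ∀ {a} b → a ≡ true → a ∨ b ≡ true
∨-introˡ b refl = refl

∨-introʳ : ∀ a {b} → b ≡ true → a ∨ b ≡ true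
∨-introʳ true  _ = refl
∨-introʳ false e = e

∨-elim : ∀ a b → a ∨ b ≡ true → a ≡ true ⊎ b ≡ true
∨-elim true  b _ = inj₁ refl
∨-elim false b e = inj₂ e

∧-elim : ∀ a b → a ∧ b ≡ true → a ≡ true × b ≡ true
∧-elim true true _ = refl , refl

any-intro : ∀ {A : Set} (p : A → Bool) {x xs} → x ∈ xs → p x ≡ true → any p xs ≡ true
any-intro p (here refl) px = ∨-introˡ _ px
any-intro p {xs = y ∷ _} (there x∈) px = ∨-introʳ (p y) (any-intro p x∈ px)

any-elim : ∀ {A : Set} (p : A → Bool) xs → any p xs ≡ true → ∃ λ x → p x ≡ true
any-elim p (x ∷ xs) e with ∨-elim (p x) (any p xs) e
... | inj₁ px = x , px
... | inj₂ e′ = any-elim p xs e′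

any-none : ∀ {A : Set} (p : A → Bool) xs → (∀ x → p x ≡ false) → any p xs ≡ false
any-none p []       _ = refl
any-none p (x ∷ xs) h rewrite h x = any-none p xs h

[_]·_ : Bool → ℕ → ℕ
[ b ]· x = if b then x else 0

[]·1≡0⇒false : ∀ b → [ b ]· 1 ≡ 0 → b ≡ false
[]·1≡0⇒false false _ = refl

count : ∀ {n} → (Fin n → Bool) → ℕ
count {n} p = ∑[ i < n ] [ p i ]· 1

∑-const : ∀ n k → ∑[ i < n ] k ≡ n * k
∑-const zero    k = refl
∑-const (suc n) k = cong (k +_) (∑-const n k)

∑-zero⁻ : ∀ {n} (f : Fin n → ℕ) → ∑ f ≡ 0 → ∀ i → f i ≡ 0
∑-zero⁻ f e zero    = m+n≡0⇒m≡0 (f zero) e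
∑-zero⁻ f e (suc i) = ∑-zero⁻ (f ∘ suc) (m+n≡0⇒n≡0 (f zero) e) i

∑-pick : ∀ {n} (f : Fin n → ℕ) i → f i ≤ ∑ f
∑-pick f zero    = m≤m+n (f zero) _
∑-pick f (suc i) = ≤-trans (∑-pick (f ∘ suc) i) (m≤n+m _ (f zero))

∑-pick₂ : ∀ {n} (f : Fin n → ℕ) {i j} → i ≢ j → f i + f j ≤ ∑ f
∑-pick₂ f {zero}  {zero}  i≢j = ⊥-elim (i≢j refl)
∑-pick₂ f {zero}  {suc j} _   = +-monoʳ-≤ (f zero) (∑-pick (f ∘ suc) j)
∑-pick₂ f {suc i} {zero}  _   =
  ≤-trans (≤-reflexive (+-comm (f (suc i)) (f zero))) (+-monoʳ-≤ (f zero) (∑-pick (f ∘ suc) i))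
∑-pick₂ f {suc i} {suc j} i≢j =
  ≤-trans (∑-pick₂ (f ∘ suc) (i≢j ∘ cong suc)) (m≤n+m _ (f zero))

∑-zero : ∀ {n} {f : Fin n → ℕ} → (∀ i → f i ≡ 0) → ∑ f ≡ 0
∑-zero {zero}  _ = refl
∑-zero {suc n} h = cong₂ _+_ (h zero) (∑-zero (h ∘ suc))

∑-single : ∀ {n} (f : Fin n → ℕ) x → (∀ i → i ≢ x → f i ≡ 0) → ∑ f ≡ f x
∑-single f zero    h = trans (cong (f zero +_) (∑-zero (λ i → h (suc i) λ ()))) (+-identityʳ _)
∑-single f (suc x) h = trans (cong (_+ ∑ (f ∘ suc)) (h zero λ ()))
  (∑-single (f ∘ suc) x (λ i i≢x → h (suc i) (i≢x ∘ FP.suc-injective)))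

∑-at : ∀ {n} (c : Fin n) (f : Fin n → ℕ) → ∑[ j < n ] [ ⌊ c ≟ j ⌋ ]· f j ≡ f c
∑-at c f = trans (∑-single _ c (λ j j≢c → cong ([_]· f j) (⌊⌋-false (c ≟ j) (j≢c ∘ sym))))
                 (cong ([_]· f c) (⌊⌋-true (c ≟ c) refl))

∑-at-∧ : ∀ {n} (c : Fin n) (p : Fin n → Bool) (f : Fin n → ℕ) →
  ∑[ j < n ] [ ⌊ c ≟ j ⌋ ∧ p j ]· f j ≡ [ p c ]· f c
∑-at-∧ c p f = trans
  (∑-single _ c (λ j j≢c → cong (λ b → [ b ∧ p j ]· f j) (⌊⌋-false (c ≟ j) (j≢c ∘ sym))))
  (cong (λ b → [ b ∧ p c ]· f c) (⌊⌋-true (c ≟ c) refl))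

∑-distrib-+₃ : ∀ {n} (f g h : Fin n → ℕ) → ∑[ i < n ] (f i + g i + h i) ≡ ∑ f + ∑ g + ∑ h
∑-distrib-+₃ f g h = trans (∑-distrib-+ (λ i → f i + g i) h) (cong (_+ ∑ h) (∑-distrib-+ f g))

count-≟ : ∀ {n} (c : Fin n) → count (λ j → ⌊ c ≟ j ⌋) ≡ 1
count-≟ c = ∑-at c (λ _ → 1)

count-≥1 : ∀ {n} (p : Fin n → Bool) {v} → p v ≡ true → 1 ≤ count p
count-≥1 p {v} pv = subst (λ b → [ b ]· 1 ≤ count p) pv (∑-pick (λ i → [ p i ]· 1) v)

count-≥2 : ∀ {n} (p : Fin n → Bool) {u v} → u ≢ v → p u ≡ true → p v ≡ true → 2 ≤ count p
count-≥2 p {u} {v} u≢v pu pv =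
  subst₂ (λ b b′ → [ b ]· 1 + [ b′ ]· 1 ≤ count p) pu pv (∑-pick₂ (λ i → [ p i ]· 1) u≢v)

∑-at₂ : ∀ {n} {a b : Fin n} (f : Fin n → ℕ) → a ≢ b →
  ∑[ u < n ] [ ⌊ a ≟ u ⌋ ∨ ⌊ b ≟ u ⌋ ]· f u ≡ f a + f b
∑-at₂ {n} {a} {b} f a≢b = begin
  ∑[ u < n ] [ ⌊ a ≟ u ⌋ ∨ ⌊ b ≟ u ⌋ ]· f u
    ≡⟨ sum-cong-≗ split ⟩
  ∑[ u < n ] ([ ⌊ a ≟ u ⌋ ]· f u + [ ⌊ b ≟ u ⌋ ]· f u)
    ≡⟨ ∑-distrib-+ (λ u → [ ⌊ a ≟ u ⌋ ]· f u) (λ u → [ ⌊ b ≟ u ⌋ ]· f u) ⟩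
  ∑[ u < n ] [ ⌊ a ≟ u ⌋ ]· f u + ∑[ u < n ] [ ⌊ b ≟ u ⌋ ]· f u
    ≡⟨ cong₂ _+_ (∑-at a f) (∑-at b f) ⟩
  f a + f b ∎
  where
  open ≡-Reasoning
  split : ∀ u → [ ⌊ a ≟ u ⌋ ∨ ⌊ b ≟ u ⌋ ]· f u ≡ [ ⌊ a ≟ u ⌋ ]· f u + [ ⌊ b ≟ u ⌋ ]· f u
  split u with a ≟ u
  ... | yes refl rewrite ⌊⌋-false (b ≟ a) (a≢b ∘ sym) = sym (+-identityʳ (f a))
  ... | no _ = refl

count+count-not : ∀ {n} (p : Fin n → Bool) → count p + count (not ∘ p) ≡ n
count+count-not {n} p = begin
  count p + count (not ∘ p)                     ≡⟨ ∑-distrib-+ (λ i → [ p i ]· 1) _ ⟨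
  ∑[ i < n ] ([ p i ]· 1 + [ not (p i) ]· 1)     ≡⟨ sum-cong-≗ (λ i → one (p i)) ⟩
  ∑[ i < n ] 1                                  ≡⟨ ∑-const n 1 ⟩
  n * 1                                         ≡⟨ *-identityʳ n ⟩
  n                                             ∎
  where
  open ≡-Reasoning
  one : ∀ b → [ b ]· 1 + [ not b ]· 1 ≡ 1
  one true  = refl
  one false = refl

trichotomy-· : ∀ {n} (c j : Fin n) x →
  [ ⌊ c <? j ⌋ ]· x + [ ⌊ j <? c ⌋ ]· x + [ ⌊ c ≟ j ⌋ ]· x ≡ x
trichotomy-· c j x with FP.<-cmp c j
... | tri< c<j _ j≮c rewrite ⌊⌋-true (c <? j) c<j | ⌊⌋-false (j <? c) j≮c
                           | ⌊⌋-false (c ≟ j) (FP.<⇒≢ c<j) = trans (+-identityʳ _) (+-identityʳ x)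
... | tri≈ c≮c refl _ rewrite ⌊⌋-false (c <? c) c≮c | ⌊⌋-true (c ≟ c) refl = refl
... | tri> c≮j j≢c j<c rewrite ⌊⌋-false (c <? j) c≮j | ⌊⌋-true (j <? c) j<c
                           | ⌊⌋-false (c ≟ j) (FP.<⇒≢ j<c ∘ sym) = +-identityʳ x

∑-trichotomy : ∀ {n} (c : Fin n) (f : Fin n → ℕ) →
  ∑[ j < n ] [ ⌊ c <? j ⌋ ]· f j + ∑[ j < n ] [ ⌊ j <? c ⌋ ]· f j + f c ≡ ∑ f
∑-trichotomy {n} c f = begin
  ∑[ j < n ] [ ⌊ c <? j ⌋ ]· f j + ∑[ j < n ] [ ⌊ j <? c ⌋ ]· f j + f c
    ≡⟨ cong₂ _+_ (∑-distrib-+ (λ j → [ ⌊ c <? j ⌋ ]· f j) _) (∑-at c f) ⟨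
  ∑[ j < n ] ([ ⌊ c <? j ⌋ ]· f j + [ ⌊ j <? c ⌋ ]· f j) + ∑[ j < n ] [ ⌊ c ≟ j ⌋ ]· f j
    ≡⟨ ∑-distrib-+ (λ j → [ ⌊ c <? j ⌋ ]· f j + [ ⌊ j <? c ⌋ ]· f j) _ ⟨
  ∑[ j < n ] ([ ⌊ c <? j ⌋ ]· f j + [ ⌊ j <? c ⌋ ]· f j + [ ⌊ c ≟ j ⌋ ]· f j)
    ≡⟨ sum-cong-≗ (λ j → trichotomy-· c j (f j)) ⟩
  ∑ f ∎
  where open ≡-Reasoning

sum-tabulate : ∀ {n} (f : Fin n → ℕ) → sum (tabulate f) ≡ ∑ f
sum-tabulate {zero}  f = refl
sum-tabulate {suc n} f = cong (f zero +_) (sum-tabulate (f ∘ suc))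

sum-map-allFin : ∀ {n} (f : Fin n → ℕ) → sum (map f (allFin n)) ≡ ∑ f
sum-map-allFin {n} f = trans (cong sum (LP.map-tabulate (λ i → i) f)) (sum-tabulate f)

sum-map-++ : ∀ {A : Set} (f : A → ℕ) xs ys → sum (map f (xs ++ ys)) ≡ sum (map f xs) + sum (map f ys)
sum-map-++ f xs ys = trans (cong sum (LP.map-++ f xs ys)) (sum-++ (map f xs) (map f ys))

sum-map-filter : ∀ {A : Set} (p : A → Bool) (f : A → ℕ) xs →
  sum (map f (filter (T? ∘ p) xs)) ≡ sum (map (λ x → [ p x ]· f x) xs)
sum-map-filter p f [] = refl
sum-map-filter p f (x ∷ xs) with p x
... | true  = cong (f x +_) (sum-map-filter p f xs)
... | false = sum-map-filter p f xs

length-filter : ∀ {A : Set} (p : A → Bool) xs → length (filter (T? ∘ p) xs) ≡ sum (map (λ x → [ p x ]· 1) xs)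
length-filter p [] = refl
length-filter p (x ∷ xs) with p x
... | true  = cong suc (length-filter p xs)
... | false = length-filter p xs

length-as-sum : ∀ {A : Set} (xs : List A) → length xs ≡ sum (map (λ _ → 1) xs)
length-as-sum []       = refl
length-as-sum (_ ∷ xs) = cong suc (length-as-sum xs)

length-sublists : ∀ {X : Set} (xs : List X) → length (sublists xs) ≡ 2 ^ length xs
length-sublists []       = refl
length-sublists (x ∷ xs) = begin
  length (map (x ∷_) (sublists xs) ++ sublists xs)          ≡⟨ LP.length-++ (map (x ∷_) (sublists xs)) ⟩
  length (map (x ∷_) (sublists xs)) + length (sublists xs)  ≡⟨ cong (_+ _) (LP.length-map (x ∷_) (sublists xs)) ⟩
  length (sublists xs) + length (sublists xs)               ≡⟨ cong (λ k → k + k) (length-sublists xs) ⟩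
  2 ^ length xs + 2 ^ length xs                             ≡⟨ cong (2 ^ length xs +_) (+-identityʳ _) ⟨
  2 ^ suc (length xs)                                       ∎
  where open ≡-Reasoning

sum-sublists-of-cons : ∀ {X : Set} (H : List X → ℕ) x xs →
  sum (map H (sublists (x ∷ xs))) ≡ sum (map (H ∘ (x ∷_)) (sublists xs)) + sum (map H (sublists xs))
sum-sublists-of-cons H x xs =
  trans (sum-map-++ H (map (x ∷_) (sublists xs)) (sublists xs))
        (cong (_+ _) (cong sum (sym (LP.map-∘ (sublists xs)))))

sum-sublists-vanishing : ∀ {X : Set} (H : List X → ℕ) xs →
  (∀ {y} A → y ∈ xs → H (y ∷ A) ≡ 0) → sum (map H (sublists xs)) ≡ H []
sum-sublists-vanishing H []       _ = +-identityʳ (H [])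
sum-sublists-vanishing H (y ∷ ys) h = begin
  sum (map H (sublists (y ∷ ys)))                                       ≡⟨ sum-sublists-of-cons H y ys ⟩
  sum (map (H ∘ (y ∷_)) (sublists ys)) + sum (map H (sublists ys))    ≡⟨ cong₂ _+_ y-part ys-part ⟩
  H []                                                                 ∎
  where
  open ≡-Reasoning
  y-part : sum (map (H ∘ (y ∷_)) (sublists ys)) ≡ 0
  y-part = trans (cong sum (LP.map-cong (λ A → h A (here refl)) (sublists ys)))
                 (sum-zeros (sublists ys))
    where
    sum-zeros : ∀ {A : Set} (zs : List A) → sum (map (λ _ → 0) zs) ≡ 0
    sum-zeros []       = refl
    sum-zeros (_ ∷ zs) = sum-zeros zs
  ys-part : sum (map H (sublists ys)) ≡ H []
  ys-part = sum-sublists-vanishing H ys (λ A y∈ → h A (there y∈))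

sum-sublists-≤1 : ∀ {X : Set} (H : List X → ℕ) xs → Unique xs →
  (∀ {x y} A → x ∈ xs → y ∈ xs → x ≢ y → H (x ∷ y ∷ A) ≡ 0) →
  sum (map H (sublists xs)) ≡ H [] + sum (map (λ x → H (x ∷ [])) xs)
sum-sublists-≤1 H []       _          _ = refl
sum-sublists-≤1 H (x ∷ xs) (x∉ ∷ !xs) h = begin
  sum (map H (sublists (x ∷ xs)))                                    ≡⟨ sum-sublists-of-cons H x xs ⟩
  sum (map (H ∘ (x ∷_)) (sublists xs)) + sum (map H (sublists xs))  ≡⟨ cong₂ _+_ x-part xs-part ⟩
  H (x ∷ []) + (H [] + S)                                            ≡⟨ +-assoc (H (x ∷ [])) (H []) S ⟨
  H (x ∷ []) + H [] + S                                              ≡⟨ cong (_+ S) (+-comm (H (x ∷ [])) (H [])) ⟩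
  H [] + H (x ∷ []) + S                                              ≡⟨ +-assoc (H []) (H (x ∷ [])) S ⟩
  H [] + (H (x ∷ []) + S)                                            ∎
  where
  open ≡-Reasoning
  S : ℕ
  S = sum (map (λ y → H (y ∷ [])) xs)
  x-part : sum (map (H ∘ (x ∷_)) (sublists xs)) ≡ H (x ∷ [])
  x-part = sum-sublists-vanishing (H ∘ (x ∷_)) xs
             (λ A y∈ → h A (here refl) (there y∈) (All.lookup x∉ y∈))
  xs-part : sum (map H (sublists xs)) ≡ H [] + S
  xs-part = sum-sublists-≤1 H xs !xs (λ A x∈ y∈ → h A (there x∈) (there y∈))

sum-concatMap : ∀ {A B : Set} (f : B → ℕ) (g : A → List B) xs →
  sum (map f (concatMap g xs)) ≡ sum (map (λ x → sum (map f (g x))) xs)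
sum-concatMap f g []       = refl
sum-concatMap f g (x ∷ xs) = trans (sum-map-++ f (g x) (concatMap g xs)) (cong (_ +_) (sum-concatMap f g xs))

module _ {n} (G : Graph n) where

  allPairs : List (Edge n)
  allPairs = cartesianProduct (allFin n) (allFin n)

  isEdge : Edge n → Bool
  isEdge (i , j) = ⌊ i <? j ⌋ ∧ adj G i j

  sum-edges : ∀ (f : Edge n → ℕ) →
    sum (map f (edges G)) ≡ ∑[ i < n ] ∑[ j < n ] [ isEdge (i , j) ]· f (i , j)
  sum-edges f = trans (sum-concatMap f _ (allFin n))
    (trans (cong sum (LP.map-cong row (allFin n))) (sum-map-allFin {n} _))
    where
    cell : ∀ b (e : Edge n) → sum (map f (if b then e ∷ [] else [])) ≡ [ b ]· f e
    cell true  e = +-identityʳ (f e)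
    cell false e = refl
    row : ∀ i → sum (map f (concatMap (λ j → if isEdge (i , j) then (i , j) ∷ [] else []) (allFin n)))
              ≡ ∑[ j < n ] [ isEdge (i , j) ]· f (i , j)
    row i = trans (sum-concatMap f _ (allFin n))
      (trans (cong sum (LP.map-cong (λ j → cell (isEdge (i , j)) (i , j)) (allFin n))) (sum-map-allFin {n} _))

  edges-as-filter : edges G ≡ filter (T? ∘ isEdge) allPairs
  edges-as-filter = go (allFin n)
    where
    row : ∀ i ys → concatMap (λ j → if isEdge (i , j) then (i , j) ∷ [] else []) ys
                 ≡ filter (T? ∘ isEdge) (map (i ,_) ys)
    row i []       = refl
    row i (y ∷ ys) with isEdge (i , y)
    ... | true  = cong ((i , y) ∷_) (row i ys)
    ... | false = row i ys
    go : ∀ xs → concatMap (λ i → concatMap (λ j → if isEdge (i , j) then (i , j) ∷ [] else []) (allFin n)) xs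
              ≡ filter (T? ∘ isEdge) (cartesianProduct xs (allFin n))
    go []       = refl
    go (x ∷ xs) = trans (cong₂ _++_ (row x (allFin n)) (go xs))
      (sym (LP.filter-++ (T? ∘ isEdge) (map (x ,_) (allFin n)) (cartesianProduct xs (allFin n))))

  edges-unique : Unique (edges G)
  edges-unique = subst Unique (sym edges-as-filter) (UP.filter⁺ (T? ∘ isEdge) {allPairs}
    (UP.cartesianProduct⁺ {xs = allFin n} {ys = allFin n} (UP.allFin⁺ n) (UP.allFin⁺ n)))

  ∈-edges⁻ : ∀ {i j} → (i , j) ∈ edges G → i F.< j × adj G i j ≡ true
  ∈-edges⁻ {i} {j} e∈ = witness (i <? j) (proj₁ i<j×ij) , proj₂ i<j×ij
    where
    i<j×ij : ⌊ i <? j ⌋ ≡ true × adj G i j ≡ true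
    i<j×ij = ∧-elim ⌊ i <? j ⌋ (adj G i j) (T-≡ .Equivalence.to
      (proj₂ (MP.∈-filter⁻ (T? ∘ isEdge) {xs = allPairs} (subst ((i , j) ∈_) edges-as-filter e∈))))

reach-refl : ∀ {n} (A : List (Edge n)) k u → reachWithin k A u u ≡ true
reach-refl A zero    u = ⌊⌋-true (u ≟ u) refl
reach-refl A (suc k) u = ∨-introˡ _ (reach-refl A k u)

reach-step : ∀ {n} (A : List (Edge n)) k {u w v} →
  reachWithin k A u w ≡ true → joinedBy A w v ≡ true → reachWithin (suc k) A u v ≡ true
reach-step A k {u} {w} {v} r j = ∨-introʳ (reachWithin k A u v)
  (any-intro (λ x → reachWithin k A u x ∧ joinedBy A x v) (MP.∈-allFin w) (cong₂ _∧_ r j))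

sameComp-refl : ∀ {n} (A : List (Edge n)) u → sameComp A u u ≡ true
sameComp-refl {n} A = reach-refl A n

sameComp-edge : ∀ {n} (A : List (Edge n)) {u v} → joinedBy A u v ≡ true → sameComp A u v ≡ true
sameComp-edge {suc k} A {u} j = reach-step A k (reach-refl A k u) j

sameComp-path₂ : ∀ {n} (A : List (Edge n)) → 2 ≤ n → ∀ {u w v} →
  joinedBy A u w ≡ true → joinedBy A w v ≡ true → sameComp A u v ≡ true
sameComp-path₂ {suc (suc k)} A _ {u} j₁ j₂ = reach-step A (suc k) (reach-step A k (reach-refl A k u) j₁) j₂
sameComp-path₂ {suc zero} A (s≤s ())

isLeast-false : ∀ {n} (A : List (Edge n)) {u v} → u F.< v → sameComp A v u ≡ true → isLeastInComp A v ≡ false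
isLeast-false A {u} {v} u<v vu = cong not (any-intro _ (MP.∈-allFin u) (cong₂ _∧_ vu (⌊⌋-true (u <? v) u<v)))

joinedBy-head : ∀ {n} (a b : Fin n) A → joinedBy ((a , b) ∷ A) a b ≡ true
joinedBy-head a b A rewrite ⌊⌋-true (a ≟ a) refl | ⌊⌋-true (b ≟ b) refl = refl

joinedBy-head′ : ∀ {n} (a b : Fin n) A → joinedBy ((a , b) ∷ A) b a ≡ true
joinedBy-head′ a b A rewrite ⌊⌋-true (a ≟ a) refl | ⌊⌋-true (b ≟ b) refl =
  ∨-introˡ _ (∨-introʳ (⌊ a ≟ b ⌋ ∧ ⌊ b ≟ a ⌋) refl)

joinedBy-there : ∀ {n} e (A : List (Edge n)) {u v} → joinedBy A u v ≡ true → joinedBy (e ∷ A) u v ≡ true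
joinedBy-there e A j = ∨-introʳ _ j

unmarked : ∀ {X : Set} → (X → ℕ) → X → Mark
unmarked ω x = (ω x , 0)

-- On the mark of a component C, d·w is (|C| − 1)·ω(C): ω a + ω b for an edge
-- {a, b}, and 0 for an isolated vertex.
d·w : Mark → ℕ
d·w (w , d) = d * w

Σd·w : List Mark → ℕ
Σd·w ms = sum (map d·w ms)

⨁-unmarked : ∀ {X : Set} (ω : X → ℕ) xs → ⨁ (map (unmarked ω) xs) ≡ (sum (map ω xs) , length xs ∸ 1)
⨁-unmarked ω []           = refl
⨁-unmarked ω (x ∷ [])     = cong (_, 0) (sym (+-identityʳ (ω x)))
⨁-unmarked ω (x ∷ y ∷ xs) rewrite ⨁-unmarked ω (y ∷ xs) =
  cong (ω x + sum (map ω (y ∷ xs)) ,_) (+-comm (length xs) 1)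

compMark-unmarked : ∀ {n} (ω : Fin n → ℕ) A v →
  compMark (unmarked ω) A v ≡ (∑[ u < n ] [ sameComp A v u ]· ω u , count (sameComp A v) ∸ 1)
compMark-unmarked {n} ω A v = trans (⨁-unmarked ω (filter (T? ∘ sameComp A v) (allFin n)))
  (cong₂ _,_ (trans (sum-map-filter (sameComp A v) ω (allFin n)) (sum-map-allFin {n} _))
             (cong (_∸ 1) (trans (length-filter (sameComp A v) (allFin n)) (sum-map-allFin {n} _))))

compMark-isolated : ∀ {n} (ω : Fin n → ℕ) A v → (∀ u → sameComp A v u ≡ ⌊ v ≟ u ⌋) →
  compMark (unmarked ω) A v ≡ unmarked ω v
compMark-isolated ω A v isolated = trans (compMark-unmarked ω A v) (cong₂ _,_
  (trans (sum-cong-≗ (λ u → cong ([_]· ω u) (isolated u))) (∑-at v ω))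
  (cong (_∸ 1) (trans (sum-cong-≗ (λ u → cong ([_]· 1) (isolated u))) (count-≟ v))))

length-monomial : ∀ {n} (m : Fin n → Mark) A → length (monomial m A) ≡ count (isLeastInComp A)
length-monomial {n} m A = trans (LP.length-map (compMark m A) (filter (T? ∘ isLeastInComp A) (allFin n)))
  (trans (length-filter (isLeastInComp A) (allFin n)) (sum-map-allFin {n} _))

m≢m+k∸j : ∀ m {k j} → j < k → m ≢ m + k ∸ j
m≢m+k∸j m {k} {j} j<k m≡ = <⇒≢ (m<n⇒0<n∸m j<k) (sym (+-cancelˡ-≡ m (k ∸ j) 0 (begin
  m + (k ∸ j) ≡⟨ +-∸-assoc m (<⇒≤ j<k) ⟨
  m + k ∸ j   ≡⟨ m≡ ⟨
  m           ≡⟨ +-identityʳ m ⟨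
  m + 0       ∎)))
  where open ≡-Reasoning

-- Every vertex that is not least in its component removes one variable.
length-monomial-≢ : ∀ {n} (m : Fin n → Mark) A {j} → j < count (not ∘ isLeastInComp A) →
  length (monomial m A) ≢ n ∸ j
length-monomial-≢ {n} m A {j} j<k eq =
  m≢m+k∸j (length (monomial m A)) j<k (trans eq (cong (_∸ j) (sym length+nonLeast)))
  where
  length+nonLeast : length (monomial m A) + count (not ∘ isLeastInComp A) ≡ n
  length+nonLeast = trans (cong (_+ _) (length-monomial m A)) (count+count-not (isLeastInComp A))

Σd·w-monomial : ∀ {n} (m : Fin n → Mark) A →
  Σd·w (monomial m A) ≡ ∑[ v < n ] [ isLeastInComp A v ]· d·w (compMark m A v)
Σd·w-monomial {n} m A = trans (cong sum (sym (LP.map-∘ (filter (T? ∘ isLeastInComp A) (allFin n)))))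
  (trans (sum-map-filter (isLeastInComp A) (d·w ∘ compMark m A) (allFin n)) (sum-map-allFin {n} _))

hasLength? : ∀ {A : Set} k (xs : List A) → Dec (length xs ≡ k)
hasLength? k xs = length xs ℕ.≟ k

Σd·w-of-length : ℕ → List (List Mark) → ℕ
Σd·w-of-length k P = sum (map (λ mono → [ ⌊ hasLength? k mono ⌋ ]· Σd·w mono) P)

Σd·w-of-length-resp : ∀ k {P Q} → P ≈Poly Q → Σd·w-of-length k P ≡ Σd·w-of-length k Q
Σd·w-of-length-resp k eq = sum-↭ (PermP.↭ₛ⇒↭ (SP.map⁺ (setoid ℕ) term-resp eq))
  where
  term-resp : ∀ {ms ms′ : List Mark} → ms PermP.↭ ms′ →
    [ ⌊ hasLength? k ms ⌋ ]· Σd·w ms ≡ [ ⌊ hasLength? k ms′ ⌋ ]· Σd·w ms′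
  term-resp p rewrite PPP.↭-length p | sum-↭ (PPP.map⁺ d·w p) = refl

reach-[] : ∀ {n} k (u v : Fin n) → reachWithin k [] u v ≡ ⌊ u ≟ v ⌋
reach-[] zero    u v = refl
reach-[] (suc k) u v rewrite reach-[] k u v =
  trans (cong (⌊ u ≟ v ⌋ ∨_) (any-none _ (allFin _) (λ w → ∧-zeroʳ (reachWithin k [] u w))))
        (∨-identityʳ ⌊ u ≟ v ⌋)

isLeast-[] : ∀ {n} (v : Fin n) → isLeastInComp [] v ≡ true
isLeast-[] {n} v = cong not (any-none _ (allFin n) none-below)
  where
  none-below : ∀ u → (sameComp [] v u ∧ ⌊ u <? v ⌋) ≡ false
  none-below u rewrite reach-[] n v u with v ≟ u
  ... | yes refl = ⌊⌋-false (v <? v) (FP.<-irrefl refl)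
  ... | no _     = refl

monomial-[] : ∀ {n} (ω : Fin n → ℕ) → monomial (unmarked ω) [] ≡ map (unmarked ω) (allFin n)
monomial-[] {n} ω = trans (cong (map (compMark (unmarked ω) [])) all-least)
  (LP.map-cong (λ v → compMark-isolated ω [] v (reach-[] n v)) (allFin n))
  where
  all-least : filter (T? ∘ isLeastInComp []) (allFin n) ≡ allFin n
  all-least = LP.filter-all (T? ∘ isLeastInComp [])
    (All.universal (λ v → T-≡ .Equivalence.from (isLeast-[] v)) (allFin n))

length-monomial-[] : ∀ {n} (ω : Fin n → ℕ) → length (monomial (unmarked ω) []) ≡ n
length-monomial-[] {n} ω = trans (cong length (monomial-[] ω))
  (trans (LP.length-map (unmarked ω) (allFin n)) (LP.length-tabulate (λ i → i)))

-- Only A = ∅ leaves all n vertices in distinct components.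
monomials-of-length-n : ∀ {n} (ω : Fin n → ℕ) (xs : List (Edge n)) → (∀ {a b} → (a , b) ∈ xs → a F.< b) →
  filter (hasLength? n) (map (monomial (unmarked ω)) (sublists xs))
    ≡ monomial (unmarked ω) [] ∷ []
monomials-of-length-n ω [] _ = LP.filter-accept (hasLength? _) (length-monomial-[] ω)
monomials-of-length-n {n} ω ((a , b) ∷ xs) ordered = begin
  filter (hasLength? n) (map mono (map ((a , b) ∷_) (sublists xs) ++ sublists xs))
    ≡⟨ cong (filter (hasLength? n)) (LP.map-++ mono (map ((a , b) ∷_) (sublists xs)) (sublists xs)) ⟩
  filter (hasLength? n) (map mono (map ((a , b) ∷_) (sublists xs)) ++ map mono (sublists xs))
    ≡⟨ LP.filter-++ (hasLength? n) (map mono (map ((a , b) ∷_) (sublists xs))) (map mono (sublists xs)) ⟩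
  filter (hasLength? n) (map mono (map ((a , b) ∷_) (sublists xs))) ++ filter (hasLength? n) (map mono (sublists xs))
    ≡⟨ cong₂ _++_ (LP.filter-none (hasLength? n) (AllP.map⁺ (AllP.map⁺ (All.universal too-short (sublists xs)))))
                  (monomials-of-length-n ω xs (ordered ∘ there)) ⟩
  monomial (unmarked ω) [] ∷ [] ∎
  where
  open ≡-Reasoning
  mono : List (Edge n) → List Mark
  mono = monomial (unmarked ω)
  too-short : ∀ A → length (mono ((a , b) ∷ A)) ≢ n
  too-short A = length-monomial-≢ (unmarked ω) ((a , b) ∷ A) (count-≥1 (not ∘ isLeastInComp ((a , b) ∷ A)) b-not-least)
    where
    b-not-least : not (isLeastInComp ((a , b) ∷ A) b) ≡ true
    b-not-least = cong not (isLeast-false ((a , b) ∷ A) (ordered (here refl))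
                                          (sameComp-edge ((a , b) ∷ A) (joinedBy-head′ a b A)))

count-nonLeast-≥2 : ∀ {n} (A : List (Edge n)) {m m′ u v} → u ≢ v → m F.< u → m′ F.< v →
  sameComp A u m ≡ true → sameComp A v m′ ≡ true → 2 ≤ count (not ∘ isLeastInComp A)
count-nonLeast-≥2 A u≢v m<u m′<v um vm′ =
  count-≥2 (not ∘ isLeastInComp A) u≢v (cong not (isLeast-false A m<u um)) (cong not (isLeast-false A m′<v vm′))

Together : ∀ {n} → List (Edge n) → Fin n → Fin n → Set
Together A u v = sameComp A u v ≡ true × sameComp A v u ≡ true

count-nonLeast-≥2-of-triangle : ∀ {n} (A : List (Edge n)) {x y z} → x ≢ y → y ≢ z → x ≢ z →
  Together A x y → Together A y z → Together A x z → 2 ≤ count (not ∘ isLeastInComp A)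
count-nonLeast-≥2-of-triangle A {x} {y} {z} x≢y y≢z x≢z (xy , yx) (yz , zy) (xz , zx)
  with FP.<-cmp x y
... | tri≈ _ x≡y _ = ⊥-elim (x≢y x≡y)
... | tri< x<y _ _ with FP.<-cmp x z
...   | tri< x<z _ _ = count-nonLeast-≥2 A y≢z x<y x<z yx zx
...   | tri≈ _ x≡z _ = ⊥-elim (x≢z x≡z)
...   | tri> _ _ z<x = count-nonLeast-≥2 A (x≢y ∘ sym) x<y z<x yx xz
count-nonLeast-≥2-of-triangle A {x} {y} {z} x≢y y≢z x≢z (xy , yx) (yz , zy) (xz , zx)
  | tri> _ _ y<x with FP.<-cmp y z
...   | tri< y<z _ _ = count-nonLeast-≥2 A x≢z y<x y<z xy zy
...   | tri≈ _ y≡z _ = ⊥-elim (y≢z y≡z)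
...   | tri> _ _ z<y = count-nonLeast-≥2 A x≢y y<x z<y xy yz

module SingleEdge {n} (ω : Fin n → ℕ) {a b : Fin n} (a<b : a F.< b) where

  A₁ : List (Edge n)
  A₁ = (a , b) ∷ []

  a≢b : a ≢ b
  a≢b = FP.<⇒≢ a<b

  Linked : Fin n → Fin n → Set
  Linked u v = u ≡ v ⊎ (u ≡ a × v ≡ b) ⊎ (u ≡ b × v ≡ a)

  joinedBy-A₁⁻ : ∀ {w v} → joinedBy A₁ w v ≡ true → (w ≡ a × v ≡ b) ⊎ (w ≡ b × v ≡ a)
  joinedBy-A₁⁻ {w} {v} e with ∨-elim _ false e
  ... | inj₂ ()
  ... | inj₁ e′ with ∨-elim (⌊ a ≟ w ⌋ ∧ ⌊ b ≟ v ⌋) (⌊ a ≟ v ⌋ ∧ ⌊ b ≟ w ⌋) e′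
  ...   | inj₁ e₁ = let aw , bv = ∧-elim _ _ e₁ in inj₁ (sym (witness (a ≟ w) aw) , sym (witness (b ≟ v) bv))
  ...   | inj₂ e₂ = let av , bw = ∧-elim _ _ e₂ in inj₂ (sym (witness (b ≟ w) bw) , sym (witness (a ≟ v) av))

  Linked-step : ∀ {u w v} → Linked u w → (w ≡ a × v ≡ b) ⊎ (w ≡ b × v ≡ a) → Linked u v
  Linked-step (inj₁ refl)                (inj₁ (refl , refl)) = inj₂ (inj₁ (refl , refl))
  Linked-step (inj₁ refl)                (inj₂ (refl , refl)) = inj₂ (inj₂ (refl , refl))
  Linked-step (inj₂ (inj₁ (refl , refl))) (inj₁ (b≡a , _))    = ⊥-elim (a≢b (sym b≡a))
  Linked-step (inj₂ (inj₁ (refl , refl))) (inj₂ (_ , refl))   = inj₁ refl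
  Linked-step (inj₂ (inj₂ (refl , refl))) (inj₁ (_ , refl))   = inj₁ refl
  Linked-step (inj₂ (inj₂ (refl , refl))) (inj₂ (a≡b , _))    = ⊥-elim (a≢b a≡b)

  reach-A₁⁻ : ∀ k {u v} → reachWithin k A₁ u v ≡ true → Linked u v
  reach-A₁⁻ zero    {u} {v} e = inj₁ (witness (u ≟ v) e)
  reach-A₁⁻ (suc k) {u} {v} e with ∨-elim (reachWithin k A₁ u v) _ e
  ... | inj₁ r = reach-A₁⁻ k r
  ... | inj₂ r with any-elim (λ w → reachWithin k A₁ u w ∧ joinedBy A₁ w v) (allFin n) r
  ...   | w , rj with ∧-elim (reachWithin k A₁ u w) (joinedBy A₁ w v) rj
  ...     | r , j = Linked-step (reach-A₁⁻ k r) (joinedBy-A₁⁻ j)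

  sameComp-isolated : ∀ {v} → v ≢ a → v ≢ b → ∀ u → sameComp A₁ v u ≡ ⌊ v ≟ u ⌋
  sameComp-isolated {v} v≢a v≢b u with v ≟ u
  ... | yes refl = sameComp-refl A₁ v
  ... | no v≢u with sameComp A₁ v u in e
  ...   | false = refl
  ...   | true with reach-A₁⁻ n e
  ...     | inj₁ v≡u              = ⊥-elim (v≢u v≡u)
  ...     | inj₂ (inj₁ (v≡a , _)) = ⊥-elim (v≢a v≡a)
  ...     | inj₂ (inj₂ (v≡b , _)) = ⊥-elim (v≢b v≡b)

  sameComp-a : ∀ u → sameComp A₁ a u ≡ (⌊ a ≟ u ⌋ ∨ ⌊ b ≟ u ⌋)
  sameComp-a u with a ≟ u | b ≟ u
  ... | yes refl | _ = sameComp-refl A₁ a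
  ... | no _ | yes refl = sameComp-edge A₁ (joinedBy-head a b [])
  ... | no a≢u | no b≢u with sameComp A₁ a u in e
  ...   | false = refl
  ...   | true with reach-A₁⁻ n e
  ...     | inj₁ a≡u              = ⊥-elim (a≢u a≡u)
  ...     | inj₂ (inj₁ (_ , u≡b)) = ⊥-elim (b≢u (sym u≡b))
  ...     | inj₂ (inj₂ (a≡b , _)) = ⊥-elim (a≢b a≡b)

  isLeast-A₁ : ∀ v → isLeastInComp A₁ v ≡ not ⌊ b ≟ v ⌋
  isLeast-A₁ v with b ≟ v
  ... | yes refl = isLeast-false A₁ a<b (sameComp-edge A₁ (joinedBy-head′ a b []))
  ... | no b≢v = cong not (any-none _ (allFin n) none-below)
    where
    none-below : ∀ u → (sameComp A₁ v u ∧ ⌊ u <? v ⌋) ≡ false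
    none-below u with sameComp A₁ v u in e
    ... | false = refl
    ... | true with reach-A₁⁻ n e
    ...   | inj₁ refl                 = ⌊⌋-false (v <? v) (FP.<-irrefl refl)
    ...   | inj₂ (inj₁ (refl , refl)) = ⌊⌋-false (b <? a) (FP.<-asym a<b)
    ...   | inj₂ (inj₂ (v≡b , _))     = ⊥-elim (b≢v (sym v≡b))

  length-monomial-A₁ : length (monomial (unmarked ω) A₁) ≡ n ∸ 1
  length-monomial-A₁ = begin
    length (monomial (unmarked ω) A₁)   ≡⟨ length-monomial (unmarked ω) A₁ ⟩
    count (isLeastInComp A₁)            ≡⟨ m+n∸n≡m _ 1 ⟨
    count (isLeastInComp A₁) + 1 ∸ 1    ≡⟨ cong (λ k → count (isLeastInComp A₁) + k ∸ 1) one-nonLeast ⟨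
    count (isLeastInComp A₁) + count (not ∘ isLeastInComp A₁) ∸ 1
                                        ≡⟨ cong (_∸ 1) (count+count-not (isLeastInComp A₁)) ⟩
    n ∸ 1                               ∎
    where
    open ≡-Reasoning
    one-nonLeast : count (not ∘ isLeastInComp A₁) ≡ 1
    one-nonLeast = trans
      (sum-cong-≗ (λ v → cong ([_]· 1) (trans (cong not (isLeast-A₁ v)) (not-involutive ⌊ b ≟ v ⌋))))
      (count-≟ b)

  Σd·w-monomial-A₁ : Σd·w (monomial (unmarked ω) A₁) ≡ ω a + ω b
  Σd·w-monomial-A₁ = begin
    Σd·w (monomial (unmarked ω) A₁)
      ≡⟨ Σd·w-monomial (unmarked ω) A₁ ⟩
    ∑[ v < n ] [ isLeastInComp A₁ v ]· d·w (compMark (unmarked ω) A₁ v)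
      ≡⟨ ∑-single _ a only-a ⟩
    [ isLeastInComp A₁ a ]· d·w (compMark (unmarked ω) A₁ a)
      ≡⟨ cong₂ [_]·_ (trans (isLeast-A₁ a) (cong not (⌊⌋-false (b ≟ a) (a≢b ∘ sym))))
                     (cong d·w (compMark-unmarked ω A₁ a)) ⟩
    (count (sameComp A₁ a) ∸ 1) * ∑[ u < n ] [ sameComp A₁ a u ]· ω u
      ≡⟨ cong₂ (λ k s → (k ∸ 1) * s) (component-sum (λ _ → 1)) (component-sum ω) ⟩
    1 * (ω a + ω b)
      ≡⟨ *-identityˡ (ω a + ω b) ⟩
    ω a + ω b ∎
    where
    open ≡-Reasoning
    component-sum : ∀ f → ∑[ u < n ] [ sameComp A₁ a u ]· f u ≡ f a + f b
    component-sum f = trans (sum-cong-≗ (λ u → cong ([_]· f u) (sameComp-a u))) (∑-at₂ f a≢b)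
    only-a : ∀ v → v ≢ a → [ isLeastInComp A₁ v ]· d·w (compMark (unmarked ω) A₁ v) ≡ 0
    only-a v v≢a with b ≟ v
    ... | yes refl rewrite isLeast-A₁ b | ⌊⌋-true (b ≟ b) refl = refl
    ... | no b≢v rewrite compMark-isolated ω A₁ v (sameComp-isolated v≢a (b≢v ∘ sym)) with isLeastInComp A₁ v
    ...   | true  = refl
    ...   | false = refl

starAdj : ∀ {n} → Fin n → Fin n → Fin n → Bool
starAdj c i j = not ⌊ i ≟ j ⌋ ∧ (⌊ c ≟ i ⌋ ∨ ⌊ c ≟ j ⌋)

edgeWeight : ∀ {n} → (Fin n → ℕ) → Edge n → ℕ
edgeWeight ω (i , j) = ω i + ω j

StarCentredAt : ∀ {n} → Graph n → Fin n → Set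
StarCentredAt G c = ∀ i j → adj G i j ≡ starAdj c i j

module Star {n} (G : Graph n) (c : Fin n) (hc : ∀ v → v ≢ c → adj G c v ≡ true)
            (edge-count : length (edges G) ≡ n ∸ 1) where

  offCentre : Fin n → Fin n → Bool
  offCentre i j = not ⌊ c ≟ i ⌋ ∧ not ⌊ c ≟ j ⌋ ∧ isEdge G (i , j)

  isEdge-split : ∀ i j x → [ isEdge G (i , j) ]· x
    ≡ [ ⌊ c ≟ i ⌋ ∧ ⌊ i <? j ⌋ ]· x + [ ⌊ c ≟ j ⌋ ∧ ⌊ i <? j ⌋ ]· x + [ offCentre i j ]· x
  isEdge-split i j x with c ≟ i | c ≟ j
  ... | yes refl | yes refl rewrite ⌊⌋-false (c <? c) (FP.<-irrefl refl) = refl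
  ... | yes refl | no c≢j rewrite hc j (c≢j ∘ sym) with ⌊ c <? j ⌋
  ...   | true  = sym (trans (+-identityʳ _) (+-identityʳ x))
  ...   | false = refl
  isEdge-split i j x | no c≢i | yes refl rewrite Graph.sym G i c | hc i (c≢i ∘ sym) with ⌊ i <? c ⌋
  ...   | true  = sym (+-identityʳ x)
  ...   | false = refl
  isEdge-split i j x | no _ | no _ = refl

  sum-edges-around : ∀ (f : Edge n → ℕ) → sum (map f (edges G))
    ≡ ∑[ j < n ] [ ⌊ c <? j ⌋ ]· f (c , j) + ∑[ i < n ] [ ⌊ i <? c ⌋ ]· f (i , c)
      + ∑[ i < n ] ∑[ j < n ] [ offCentre i j ]· f (i , j)
  sum-edges-around f = begin
    sum (map f (edges G))                                      ≡⟨ sum-edges G f ⟩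
    ∑[ i < n ] ∑[ j < n ] [ isEdge G (i , j) ]· f (i , j)      ≡⟨ sum-cong-≗ (λ i → split-row i) ⟩
    ∑[ i < n ] (∑ (A i) + ∑ (B i) + ∑ (C i))                   ≡⟨ ∑-distrib-+₃ (∑ ∘ A) (∑ ∘ B) (∑ ∘ C) ⟩
    ∑[ i < n ] ∑ (A i) + ∑[ i < n ] ∑ (B i) + ∑[ i < n ] ∑ (C i)
      ≡⟨ cong (_+ ∑[ i < n ] ∑ (C i)) (cong₂ _+_ centre-first centre-second) ⟩
    ∑[ j < n ] [ ⌊ c <? j ⌋ ]· f (c , j) + ∑[ i < n ] [ ⌊ i <? c ⌋ ]· f (i , c)
      + ∑[ i < n ] ∑[ j < n ] [ offCentre i j ]· f (i , j) ∎
    where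
    open ≡-Reasoning
    A B C : Fin n → Fin n → ℕ
    A i j = [ ⌊ c ≟ i ⌋ ∧ ⌊ i <? j ⌋ ]· f (i , j)
    B i j = [ ⌊ c ≟ j ⌋ ∧ ⌊ i <? j ⌋ ]· f (i , j)
    C i j = [ offCentre i j ]· f (i , j)
    split-row : ∀ i → ∑[ j < n ] [ isEdge G (i , j) ]· f (i , j) ≡ ∑ (A i) + ∑ (B i) + ∑ (C i)
    split-row i = trans (sum-cong-≗ (λ j → isEdge-split i j (f (i , j)))) (∑-distrib-+₃ (A i) (B i) (C i))
    centre-first : ∑[ i < n ] ∑ (A i) ≡ ∑[ j < n ] [ ⌊ c <? j ⌋ ]· f (c , j)
    centre-first = trans (∑-comm A) (sum-cong-≗ (λ j → ∑-at-∧ c (λ i → ⌊ i <? j ⌋) (λ i → f (i , j))))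
    centre-second : ∑[ i < n ] ∑ (B i) ≡ ∑[ i < n ] [ ⌊ i <? c ⌋ ]· f (i , c)
    centre-second = sum-cong-≗ (λ i → ∑-at-∧ c (λ j → ⌊ i <? j ⌋) (λ j → f (i , j)))

  -- The n − 1 edges at the centre already exhaust the edge count.
  off-centre-absent : ∀ i j → offCentre i j ≡ false
  off-centre-absent i j = []·1≡0⇒false (offCentre i j)
    (∑-zero⁻ _ (∑-zero⁻ _ rest≡0 i) j)
    where
    at-centre rest : ℕ
    at-centre = ∑[ j < n ] [ ⌊ c <? j ⌋ ]· 1 + ∑[ i < n ] [ ⌊ i <? c ⌋ ]· 1
    rest = ∑[ i < n ] ∑[ j < n ] [ offCentre i j ]· 1
    n≡at-centre+1 : n ≡ at-centre + 1
    n≡at-centre+1 = sym (trans (∑-trichotomy c (λ _ → 1)) (trans (∑-const n 1) (*-identityʳ n)))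
    rest≡0 : rest ≡ 0
    rest≡0 = +-cancelˡ-≡ at-centre rest 0 (begin
      at-centre + rest            ≡⟨ sum-edges-around (λ _ → 1) ⟨
      sum (map (λ _ → 1) (edges G)) ≡⟨ length-as-sum (edges G) ⟨
      length (edges G)            ≡⟨ edge-count ⟩
      n ∸ 1                       ≡⟨ cong (_∸ 1) n≡at-centre+1 ⟩
      at-centre + 1 ∸ 1           ≡⟨ m+n∸n≡m at-centre 1 ⟩
      at-centre                   ≡⟨ +-identityʳ at-centre ⟨
      at-centre + 0               ∎)
      where open ≡-Reasoning

  offCentre≡adj : ∀ {i j} → i F.< j → c ≢ i → c ≢ j → offCentre i j ≡ adj G i j
  offCentre≡adj {i} {j} i<j c≢i c≢j
    rewrite ⌊⌋-false (c ≟ i) c≢i | ⌊⌋-false (c ≟ j) c≢j | ⌊⌋-true (i <? j) i<j = refl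

  adj-off-centre : ∀ {i j} → c ≢ i → c ≢ j → adj G i j ≡ false
  adj-off-centre {i} {j} c≢i c≢j with FP.<-cmp i j
  ... | tri< i<j _ _  = trans (sym (offCentre≡adj i<j c≢i c≢j)) (off-centre-absent i j)
  ... | tri≈ _ refl _ = irrefl G i
  ... | tri> _ _ j<i  = trans (Graph.sym G i j) (trans (sym (offCentre≡adj j<i c≢j c≢i)) (off-centre-absent j i))

  centred : StarCentredAt G c
  centred i j with i ≟ j
  ... | yes refl = irrefl G i
  ... | no i≢j with c ≟ i | c ≟ j
  ...   | yes refl | _        = hc j (i≢j ∘ sym)
  ...   | no c≢i   | yes refl = trans (Graph.sym G i c) (hc i (c≢i ∘ sym))
  ...   | no c≢i   | no c≢j   = adj-off-centre c≢i c≢j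

  ∈-edges⇒at-centre : ∀ {i j} → (i , j) ∈ edges G → c ≡ i ⊎ c ≡ j
  ∈-edges⇒at-centre {i} {j} e∈ with c ≟ i | c ≟ j
  ... | yes c≡i | _       = inj₁ c≡i
  ... | no _    | yes c≡j = inj₂ c≡j
  ... | no c≢i  | no c≢j  with () ← trans (sym (proj₂ (∈-edges⁻ G e∈))) (adj-off-centre c≢i c≢j)

  sum-edge-weights : ∀ (ω : Fin n → ℕ) →
    sum (map (edgeWeight ω) (edges G)) + (ω c + ω c) ≡ n * ω c + ∑ ω
  sum-edge-weights ω = begin
    sum (map w (edges G)) + (ω c + ω c)
      ≡⟨ cong (_+ (ω c + ω c)) (sum-edges-around w) ⟩
    up + down + ∑[ i < n ] ∑[ j < n ] [ offCentre i j ]· w (i , j) + (ω c + ω c)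
      ≡⟨ cong (λ r → up + down + r + (ω c + ω c)) no-off-centre ⟩
    up + down + 0 + (ω c + ω c)
      ≡⟨ cong (_+ (ω c + ω c)) (+-identityʳ (up + down)) ⟩
    up + down + (ω c + ω c)
      ≡⟨ cong (λ s → up + s + (ω c + ω c)) 
           (sum-cong-≗ (λ i → cong ([ ⌊ i <? c ⌋ ]·_) (+-comm (ω i) (ω c)))) ⟩
    up + ∑[ j < n ] [ ⌊ j <? c ⌋ ]· (ω c + ω j) + (ω c + ω c)
      ≡⟨ ∑-trichotomy c (λ j → ω c + ω j) ⟩
    ∑[ j < n ] (ω c + ω j)
      ≡⟨ ∑-distrib-+ (λ _ → ω c) ω ⟩
    ∑[ j < n ] ω c + ∑ ω
      ≡⟨ cong (_+ ∑ ω) (∑-const n (ω c)) ⟩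
    n * ω c + ∑ ω ∎
    where
    open ≡-Reasoning
    w : Edge n → ℕ
    w = edgeWeight ω
    up down : ℕ
    up   = ∑[ j < n ] [ ⌊ c <? j ⌋ ]· w (c , j)
    down = ∑[ i < n ] [ ⌊ i <? c ⌋ ]· w (i , c)
    no-off-centre : ∑[ i < n ] ∑[ j < n ] [ offCentre i j ]· w (i , j) ≡ 0
    no-off-centre = ∑-zero (λ i → ∑-zero (λ j → cong ([_]· w (i , j)) (off-centre-absent i j)))

  IsLeafEdge : Edge n → Fin n → Set
  IsLeafEdge e ℓ = e ≡ (c , ℓ) ⊎ e ≡ (ℓ , c)

  leaf : ∀ {e} → e ∈ edges G → Σ (Fin n) λ ℓ → c ≢ ℓ × IsLeafEdge e ℓ
  leaf {i , j} e∈ with ∈-edges⇒at-centre e∈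
  ... | inj₁ refl = j , FP.<⇒≢ (proj₁ (∈-edges⁻ G e∈)) , inj₁ refl
  ... | inj₂ refl = i , FP.<⇒≢ (proj₁ (∈-edges⁻ G e∈)) ∘ sym , inj₂ refl

  leafEdge-unique : ∀ {e f ℓ} → e ∈ edges G → f ∈ edges G → IsLeafEdge e ℓ → IsLeafEdge f ℓ → e ≡ f
  leafEdge-unique _  _  (inj₁ refl) (inj₁ refl) = refl
  leafEdge-unique _  _  (inj₂ refl) (inj₂ refl) = refl
  leafEdge-unique e∈ f∈ (inj₁ refl) (inj₂ refl) =
    ⊥-elim (FP.<-asym (proj₁ (∈-edges⁻ G e∈)) (proj₁ (∈-edges⁻ G f∈)))
  leafEdge-unique e∈ f∈ (inj₂ refl) (inj₁ refl) =
    ⊥-elim (FP.<-asym (proj₁ (∈-edges⁻ G e∈)) (proj₁ (∈-edges⁻ G f∈)))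

  joinedBy-leafEdge : ∀ {e ℓ} B → IsLeafEdge e ℓ →
    joinedBy (e ∷ B) c ℓ ≡ true × joinedBy (e ∷ B) ℓ c ≡ true
  joinedBy-leafEdge {ℓ = ℓ} B (inj₁ refl) = joinedBy-head c ℓ B , joinedBy-head′ c ℓ B
  joinedBy-leafEdge {ℓ = ℓ} B (inj₂ refl) = joinedBy-head′ ℓ c B , joinedBy-head ℓ c B

  -- Two edges of a star meet at the centre, so their component has three vertices.
  length-monomial-two-edges : 2 ≤ n → ∀ (m : Fin n → Mark) {e f} A →
    e ∈ edges G → f ∈ edges G → e ≢ f → length (monomial m (e ∷ f ∷ A)) ≢ n ∸ 1
  length-monomial-two-edges 2≤n m {e} {f} A e∈ f∈ e≢f with leaf e∈ | leaf f∈
  ... | ℓ , c≢ℓ , e-at-ℓ | ℓ′ , c≢ℓ′ , f-at-ℓ′ = length-monomial-≢ m B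
    (count-nonLeast-≥2-of-triangle B c≢ℓ ℓ≢ℓ′ c≢ℓ′
      (edge c-ℓ ℓ-c) (path ℓ-c c-ℓ′ , path ℓ′-c c-ℓ) (edge c-ℓ′ ℓ′-c))
    where
    B : List (Edge n)
    B = e ∷ f ∷ A
    c-ℓ : joinedBy B c ℓ ≡ true
    c-ℓ = proj₁ (joinedBy-leafEdge (f ∷ A) e-at-ℓ)
    ℓ-c : joinedBy B ℓ c ≡ true
    ℓ-c = proj₂ (joinedBy-leafEdge (f ∷ A) e-at-ℓ)
    c-ℓ′ : joinedBy B c ℓ′ ≡ true
    c-ℓ′ = joinedBy-there e (f ∷ A) (proj₁ (joinedBy-leafEdge A f-at-ℓ′))
    ℓ′-c : joinedBy B ℓ′ c ≡ true
    ℓ′-c = joinedBy-there e (f ∷ A) (proj₂ (joinedBy-leafEdge A f-at-ℓ′))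
    edge : ∀ {u v} → joinedBy B u v ≡ true → joinedBy B v u ≡ true → Together B u v
    edge uv vu = sameComp-edge B uv , sameComp-edge B vu
    path : ∀ {u v} → joinedBy B u c ≡ true → joinedBy B c v ≡ true → sameComp B u v ≡ true
    path = sameComp-path₂ B 2≤n
    ℓ≢ℓ′ : ℓ ≢ ℓ′
    ℓ≢ℓ′ refl = e≢f (leafEdge-unique e∈ f∈ e-at-ℓ f-at-ℓ′)

  length-monomial-edge : ∀ ω {e} → e ∈ edges G → length (monomial (unmarked ω) (e ∷ [])) ≡ n ∸ 1
  length-monomial-edge ω {a , b} e∈ = SingleEdge.length-monomial-A₁ ω (proj₁ (∈-edges⁻ G e∈))

  Σd·w-of-length-edges : 3 ≤ n → ∀ ω →
    Σd·w-of-length (n ∸ 1) (Mpoly G (unmarked ω)) ≡ sum (map (edgeWeight ω) (edges G))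
  Σd·w-of-length-edges 3≤n ω = begin
    Σd·w-of-length (n ∸ 1) (Mpoly G (unmarked ω))   ≡⟨ cong sum (LP.map-∘ (sublists (edges G))) ⟨
    sum (map H (sublists (edges G)))                ≡⟨ sum-sublists-≤1 H (edges G) (edges-unique G) two-edges ⟩
    H [] + sum (map (λ e → H (e ∷ [])) (edges G))
      ≡⟨ cong₂ _+_ no-edge (cong sum (LP.map-cong-local (All.tabulate one-edge))) ⟩
    sum (map (edgeWeight ω) (edges G)) ∎
    where
    open ≡-Reasoning
    mono : List (Edge n) → List Mark
    mono = monomial (unmarked ω)
    H : List (Edge n) → ℕ
    H A = [ ⌊ hasLength? (n ∸ 1) (mono A) ⌋ ]· Σd·w (mono A)
    vanishes : ∀ {A} → length (mono A) ≢ n ∸ 1 → H A ≡ 0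
    vanishes {A} ≢ = cong ([_]· Σd·w (mono A)) (⌊⌋-false (hasLength? (n ∸ 1) (mono A)) ≢)
    no-edge : H [] ≡ 0
    no-edge = vanishes (λ eq →
      <⇒≢ (∸-monoʳ-< (s≤s z≤n) (≤-trans (s≤s z≤n) 3≤n)) (trans (sym eq) (length-monomial-[] ω)))
    two-edges : ∀ {e f} A → e ∈ edges G → f ∈ edges G → e ≢ f → H (e ∷ f ∷ A) ≡ 0
    two-edges A e∈ f∈ e≢f =
      vanishes (length-monomial-two-edges (≤-trans (n≤1+n 2) 3≤n) (unmarked ω) A e∈ f∈ e≢f)
    one-edge : ∀ {e} → e ∈ edges G → H (e ∷ []) ≡ edgeWeight ω e
    one-edge {a , b} e∈ = trans
      (cong ([_]· Σd·w (mono ((a , b) ∷ [])))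
            (⌊⌋-true (hasLength? (n ∸ 1) (mono ((a , b) ∷ []))) (length-monomial-edge ω e∈)))
      (SingleEdge.Σd·w-monomial-A₁ ω (proj₁ (∈-edges⁻ G e∈)))

  centre-weight-equation : 3 ≤ n → ∀ ω →
    Σd·w-of-length (n ∸ 1) (Mpoly G (unmarked ω)) + (ω c + ω c) ≡ n * ω c + ∑ ω
  centre-weight-equation 3≤n ω =
    trans (cong (_+ (ω c + ω c)) (Σd·w-of-length-edges 3≤n ω)) (sum-edge-weights ω)

length-Mpoly : ∀ {n} (G : Graph n) (m : Fin n → Mark) → IsTree G → length (Mpoly G m) ≡ 2 ^ (n ∸ 1)
length-Mpoly G m (_ , _ , edge-count) = trans (LP.length-map (monomial m) (sublists (edges G)))
  (trans (length-sublists (edges G)) (cong (2 ^_) edge-count))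

2^-injective : ∀ {a b} → 2 ^ a ≡ 2 ^ b → a ≡ b
2^-injective {a} {b} eq with <-cmp a b
... | tri< a<b _ _ = ⊥-elim (<-irrefl eq (^-monoʳ-< 2 (s≤s (s≤s z≤n)) a<b))
... | tri≈ _ a≡b _ = a≡b
... | tri> _ _ b<a = ⊥-elim (<-irrefl (sym eq) (^-monoʳ-< 2 (s≤s (s≤s z≤n)) b<a))

size-≡ : ∀ T T′ → M T ≈Poly M T′ → size T ≡ size T′
size-≡ T T′ eq = ∸1-injective (proj₁ (isTree T)) (proj₁ (isTree T′)) (2^-injective (begin
  2 ^ (size T ∸ 1)   ≡⟨ length-Mpoly (graph T) (markω T) (isTree T) ⟨
  length (M T)       ≡⟨ SP.xs↭ys⇒|xs|≡|ys| eq ⟩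
  length (M T′)      ≡⟨ length-Mpoly (graph T′) (markω T′) (isTree T′) ⟩
  2 ^ (size T′ ∸ 1)  ∎))
  where
  open ≡-Reasoning
  ∸1-injective : ∀ {a b} → 1 ≤ a → 1 ≤ b → a ∸ 1 ≡ b ∸ 1 → a ≡ b
  ∸1-injective {suc a} {suc b} _ _ = cong suc

single-↭ : ∀ {ms ms′ : List Mark} → PermS._↭_ (PermP.↭-setoid {A = Mark}) (ms ∷ []) (ms′ ∷ []) →
  ms PermP.↭ ms′
single-↭ p with SP.∈-resp-↭ p (here PermP.↭-refl)
... | here ms↭ms′ = ms↭ms′

↭-tabulate⇒permutation : ∀ {A : Set} {n} {f g : Fin n → A} → tabulate f PermP.↭ tabulate g →
  Σ (Permutation n n) λ π → ∀ i → g (π ⟨$⟩ʳ i) ≡ f i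
↭-tabulate⇒permutation {A} {n} {f} {g} σ = π , λ i → sym (begin
  f i                                    ≡⟨ LP.lookup-tabulate f i ⟨
  lookup (tabulate f) (F.cast _ i)       ≡⟨ PermSP.onIndices-lookup (setoid A) σₛ (F.cast _ i) ⟩
  lookup (tabulate g) (Hom.onIndices σₛ ⟨$⟩ʳ F.cast _ i)
    ≡⟨ cong (lookup (tabulate g)) (FP.cast-involutive (sym |g|) |g| _) ⟨
  lookup (tabulate g) (F.cast _ (π ⟨$⟩ʳ i)) ≡⟨ LP.lookup-tabulate g _ ⟩
  g (π ⟨$⟩ʳ i)                           ∎)
  where
  open ≡-Reasoning
  σₛ : PermS._↭_ (setoid A) (tabulate f) (tabulate g)
  σₛ = PermP.↭⇒↭ₛ σ
  |g| : length (tabulate g) ≡ n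
  |g| = LP.length-tabulate g
  π : Permutation n n
  π = Perm.cast-id (sym (LP.length-tabulate f)) ∘ₚ Hom.onIndices σₛ ∘ₚ Perm.cast-id |g|

vertex-marks-↭ : ∀ {n} (G G′ : Graph n) (ω ω′ : Fin n → ℕ) →
  Mpoly G (unmarked ω) ≈Poly Mpoly G′ (unmarked ω′) → tabulate (unmarked ω) PermP.↭ tabulate (unmarked ω′)
vertex-marks-↭ {n} G G′ ω ω′ eq = subst₂ PermP._↭_ (as-tabulate ω) (as-tabulate ω′) isolated
  where
  isolated : monomial (unmarked ω) [] PermP.↭ monomial (unmarked ω′) []
  isolated = single-↭ (subst₂ (PermS._↭_ (PermP.↭-setoid {A = Mark}))
    (monomials-of-length-n ω (edges G) (λ e∈ → proj₁ (∈-edges⁻ G e∈)))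
    (monomials-of-length-n ω′ (edges G′) (λ e∈ → proj₁ (∈-edges⁻ G′ e∈)))
    (SP.filter⁺ (hasLength? n) (λ p → trans (sym (PPP.↭-length p))) eq))
  as-tabulate : ∀ ω → monomial (unmarked ω) [] ≡ tabulate (unmarked ω)
  as-tabulate ω = trans (monomial-[] ω) (LP.map-tabulate (λ i → i) (unmarked ω))

cancel-centre-weight : ∀ {n t W x y} → 3 ≤ n → t + (x + x) ≡ n * x + W → t + (y + y) ≡ n * y + W → x ≡ y
cancel-centre-weight {suc (suc (suc k))} {t} {W} {x} {y} _ ex ey =
  *-cancelˡ-≡ x y (suc k) (+-cancelʳ-≡ W (suc k * x) (suc k * y) (trans (sym (strip ex)) (strip ey)))
  where
  strip : ∀ {z} → t + (z + z) ≡ suc (suc (suc k)) * z + W → t ≡ suc k * z + W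
  strip {z} e = +-cancelˡ-≡ (z + z) t (suc k * z + W) (begin
    z + z + t                ≡⟨ +-comm (z + z) t ⟩
    t + (z + z)              ≡⟨ e ⟩
    z + (z + suc k * z) + W  ≡⟨ +-assoc z (z + suc k * z) W ⟩
    z + (z + suc k * z + W)  ≡⟨ cong (z +_) (+-assoc z (suc k * z) W) ⟩
    z + (z + (suc k * z + W)) ≡⟨ +-assoc z z (suc k * z + W) ⟨
    z + z + (suc k * z + W)  ∎)
    where open ≡-Reasoning
cancel-centre-weight {suc zero}       (s≤s ())
cancel-centre-weight {suc (suc zero)} (s≤s (s≤s ()))

≟-permute : ∀ {n} (π : Permutation n n) x y → ⌊ π ⟨$⟩ʳ x ≟ π ⟨$⟩ʳ y ⌋ ≡ ⌊ x ≟ y ⌋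
≟-permute π x y with x ≟ y
... | yes refl = ⌊⌋-true (π ⟨$⟩ʳ x ≟ π ⟨$⟩ʳ x) refl
... | no x≢y = ⌊⌋-false (π ⟨$⟩ʳ x ≟ π ⟨$⟩ʳ y)
  (λ πx≡πy → x≢y (trans (sym (Perm.inverseˡ π)) (trans (cong (π ⟨$⟩ˡ_) πx≡πy) (Perm.inverseˡ π))))

starAdj-permute : ∀ {n} (π : Permutation n n) c i j →
  starAdj (π ⟨$⟩ʳ c) (π ⟨$⟩ʳ i) (π ⟨$⟩ʳ j) ≡ starAdj c i j
starAdj-permute π c i j rewrite ≟-permute π i j | ≟-permute π c i | ≟-permute π c j = refl

centred-isomorphism : ∀ {n} (G G′ : Graph n) {c c′} → StarCentredAt G c → StarCentredAt G′ c′ →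
  (ρ : Permutation n n) → ρ ⟨$⟩ʳ c ≡ c′ → ∀ i j → adj G′ (ρ ⟨$⟩ʳ i) (ρ ⟨$⟩ʳ j) ≡ adj G i j
centred-isomorphism G G′ {c} {c′} centred centred′ ρ ρc≡c′ i j = begin
  adj G′ (ρ ⟨$⟩ʳ i) (ρ ⟨$⟩ʳ j)              ≡⟨ centred′ (ρ ⟨$⟩ʳ i) (ρ ⟨$⟩ʳ j) ⟩
  starAdj c′ (ρ ⟨$⟩ʳ i) (ρ ⟨$⟩ʳ j)          ≡⟨ cong (λ x → starAdj x (ρ ⟨$⟩ʳ i) (ρ ⟨$⟩ʳ j)) ρc≡c′ ⟨
  starAdj (ρ ⟨$⟩ʳ c) (ρ ⟨$⟩ʳ i) (ρ ⟨$⟩ʳ j)  ≡⟨ starAdj-permute ρ c i j ⟩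
  starAdj c i j                           ≡⟨ centred i j ⟨
  adj G i j                               ∎
  where open ≡-Reasoning

starAdj-Fin2 : ∀ (c i j : Fin 2) → starAdj c i j ≡ not ⌊ i ≟ j ⌋
starAdj-Fin2 _           zero       zero       = refl
starAdj-Fin2 _           (suc zero) (suc zero) = refl
starAdj-Fin2 zero        zero       (suc zero) = refl
starAdj-Fin2 (suc zero)  zero       (suc zero) = refl
starAdj-Fin2 zero        (suc zero) zero       = refl
starAdj-Fin2 (suc zero)  (suc zero) zero       = refl

every-vertex-centre : ∀ {n} (G : Graph n) {c} → n ≤ 2 → StarCentredAt G c → ∀ c′ → StarCentredAt G c′
every-vertex-centre {suc zero}       G {zero} _ centred zero = centred
every-vertex-centre {suc (suc zero)} G {c}    _ centred c′ i j =
  trans (centred i j) (trans (starAdj-Fin2 c i j) (sym (starAdj-Fin2 c′ i j)))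
every-vertex-centre {suc (suc (suc _))} G (s≤s (s≤s ()))

transpose-preserves : ∀ {n} {A : Set} (h : Fin n → A) {i j} → h i ≡ h j → ∀ k → h (PC.transpose i j k) ≡ h k
transpose-preserves h {i} {j} hi≡hj k with k ≟ i
... | yes refl = sym hi≡hj
... | no _ with k ≟ j
...   | yes refl = hi≡hj
...   | no _     = refl

-- Composing with a transposition moves c to any c′ of the same weight.
permutation-sending : ∀ {n} {ω ω′ : Fin n → ℕ} (π : Permutation n n) → (∀ i → ω′ (π ⟨$⟩ʳ i) ≡ ω i) →
  ∀ {c c′} → ω′ c′ ≡ ω c →
  Σ (Permutation n n) λ ρ → ρ ⟨$⟩ʳ c ≡ c′ × (∀ i → ω′ (ρ ⟨$⟩ʳ i) ≡ ω i)
permutation-sending {n} {ω} {ω′} π π-ω {c} {c′} ω′c′≡ωc = ρ , ρc≡c′ , ρ-ω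
  where
  ρ : Permutation n n
  ρ = π ∘ₚ Perm.transpose (π ⟨$⟩ʳ c) c′
  ρc≡c′ : ρ ⟨$⟩ʳ c ≡ c′
  ρc≡c′ rewrite dec-true (π ⟨$⟩ʳ c ≟ π ⟨$⟩ʳ c) refl = refl
  ρ-ω : ∀ i → ω′ (ρ ⟨$⟩ʳ i) ≡ ω i
  ρ-ω i = trans (transpose-preserves ω′ (trans (π-ω c) (sym ω′c′≡ωc)) (π ⟨$⟩ʳ i)) (π-ω i)

module EqualPolynomials {n} (G G′ : Graph n) (ω ω′ : Fin n → ℕ) (star : IsStar G) (star′ : IsStar G′)
                        (eq : Mpoly G (unmarked ω) ≈Poly Mpoly G′ (unmarked ω′)) where

  c c′ : Fin n
  c  = proj₁ (proj₂ star)
  c′ = proj₁ (proj₂ star′)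

  module S  = Star G c (proj₂ (proj₂ star)) (proj₂ (proj₂ (proj₁ star)))
  module S′ = Star G′ c′ (proj₂ (proj₂ star′)) (proj₂ (proj₂ (proj₁ star′)))

  π : Permutation n n
  π = proj₁ (↭-tabulate⇒permutation (vertex-marks-↭ G G′ ω ω′ eq))

  π-ω : ∀ i → ω′ (π ⟨$⟩ʳ i) ≡ ω i
  π-ω i = cong proj₁ (proj₂ (↭-tabulate⇒permutation (vertex-marks-↭ G G′ ω ω′ eq)) i)

  total-weights : ∑ ω′ ≡ ∑ ω
  total-weights = trans (∑-permute ω′ π) (sum-cong-≗ π-ω)

  centre-weights : 3 ≤ n → ω c ≡ ω′ c′
  centre-weights 3≤n = cancel-centre-weight {t = Σd·w-of-length (n ∸ 1) (Mpoly G (unmarked ω))} {W = ∑ ω}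
    3≤n (S.centre-weight-equation 3≤n ω) (begin
    Σd·w-of-length (n ∸ 1) (Mpoly G (unmarked ω)) + (ω′ c′ + ω′ c′)
      ≡⟨ cong (_+ (ω′ c′ + ω′ c′)) (Σd·w-of-length-resp (n ∸ 1) eq) ⟩
    Σd·w-of-length (n ∸ 1) (Mpoly G′ (unmarked ω′)) + (ω′ c′ + ω′ c′)
      ≡⟨ S′.centre-weight-equation 3≤n ω′ ⟩
    n * ω′ c′ + ∑ ω′
      ≡⟨ cong (n * ω′ c′ +_) total-weights ⟩
    n * ω′ c′ + ∑ ω ∎)
    where open ≡-Reasoning

  matching-centre : Σ (Fin n) λ d → StarCentredAt G′ d × ω′ d ≡ ω c
  matching-centre with n ℕ.≤? 2
  ... | yes n≤2 = π ⟨$⟩ʳ c , every-vertex-centre G′ {c′} n≤2 S′.centred (π ⟨$⟩ʳ c) , π-ω c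
  ... | no n≰2  = c′ , S′.centred , sym (centre-weights (≰⇒> n≰2))

  isomorphism : Σ (Permutation n n) λ ρ →
    (∀ i j → adj G′ (ρ ⟨$⟩ʳ i) (ρ ⟨$⟩ʳ j) ≡ adj G i j) × (∀ i → ω′ (ρ ⟨$⟩ʳ i) ≡ ω i)
  isomorphism with matching-centre
  ... | d , centred′ , ω′d≡ωc with permutation-sending {ω = ω} {ω′} π π-ω {c} {d} ω′d≡ωc
  ...   | ρ , ρc≡d , ρ-ω = ρ , centred-isomorphism G G′ S.centred centred′ ρ ρc≡d , ρ-ω

ωIsomorphic-of-equal-size : ∀ T T′ → size T ≡ size T′ → IsWeightedStar T → IsWeightedStar T′ →
  M T ≈Poly M T′ → ωIsomorphic T T′
ωIsomorphic-of-equal-size record { size = n ; graph = G ; weight = ω }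
                          record { size = .n ; graph = G′ ; weight = ω′ } refl star star′ eq =
  EqualPolynomials.isomorphism G G′ ω ω′ star star′ eq

theorem7p6 : (T T' : WeightedTree) → IsWeightedStar T → IsWeightedStar T' →
    M T ≈Poly M T' → ωIsomorphic T T'
theorem7p6 T T' star star' eq = ωIsomorphic-of-equal-size T T' (size-≡ T T' eq) star star' eq
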